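{- Let $S\subseteq[n]^2$ and let $\Theta=(\alpha,\beta,\gamma)\in S_n^3$ be an autotopism of at least one Latin square of order $n$. Define $S_{RC}=\{P\in C_\Theta : \{(r,c):(r,c,s)\in O(P)\}=S\}$, $S_{RS}=\{P\in C_\Theta : \{(r,s):(r,c,s)\in O(P)\}=S\}$, $S_{CS}=\{P\in C_\Theta : \{(c,s):(r,c,s)\in O(P)\}=S\}$. Then each of $S_{RC},S_{RS},S_{CS}$ is non-empty if and only if it is a basis of $\mathcal{LS}_\Theta$.
   Context: A Latin square of order $n$ is an $n\times n$ array over $[n]$ with each symbol exactly once in each row and column; a partial Latin square of order $n$ is an $n\times n$ array whose cells are empty or contain a symbol of $[n]$, each symbol at most once per row and column (non-empty: some cell filled). $O(P)$ is the set of (row, column, symbol) triples of filled cells. $\Theta=(\alpha,\beta,\gamma)$ is an autotopism of $P$ if $\{(\alpha(r),\beta(c),\gamma(s)):(r,c,s)\in O(P)\}=O(P)$. $\mathcal{LS}_\Theta$ is the set of Latin squares of order $n$ having $\Theta$ as autotopism; for a partial Latin square $P$, $\mathcal{LS}_{\Theta,P}=\{L\in\mathcal{LS}_\Theta: O(P)\subseteq O(L)\}$. A non-empty partial Latin square $P$ with autotopism $\Theta$ is $\Theta$-completable if $\mathcal{LS}_{\Theta,P}\neq\emptyset$; $C_\Theta$ is the set of $\Theta$-completable partial Latin squares. A set $\{P_1,\dots,P_m\}$ of $\Theta$-completable partial Latin squares is a basis of $\mathcal{LS}_\Theta$ if $\bigcup_{i}\mathcal{LS}_{\Theta,P_i}=\mathcal{LS}_\Theta$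 and $\mathcal{LS}_{\Theta,P_i}\cap\mathcal{LS}_{\Theta,P_j}=\emptyset$ for $i\neq j$. -}

module Defs where

open import Data.Nat using (ℕ)
open import Data.Fin using (Fin)
open import Data.Fin.Permutation using (Permutation′; _⟨$⟩ʳ_)
open import Data.Maybe using (Maybe; just; nothing)
open import Data.Product using (Σ; ∃; ∃-syntax; _×_; _,_)
open import Relation.Binary.PropositionalEquality using (_≡_)
open import Relation.Nullary using (¬_)
import Data.Empty
open import Function.Bundles using (_⇔_)

-- A partial n×n array: each cell empty (nothing) or a symbol (just s).
Array : ℕ → Set
Array n = Fin n → Fin n → Maybe (Fin n)

_∈O_ : ∀ {n} → Fin n × Fin n × Fin n → Array n → Set
(r , c , s) ∈O P = P r c ≡ just s

record IsPLS {n : ℕ} (P : Array n) : Set where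
  field
    row-unique : ∀ r c c' s → P r c ≡ just s → P r c' ≡ just s → c ≡ c'
    col-unique : ∀ r r' c s → P r c ≡ just s → P r' c ≡ just s → r ≡ r'
    nonempty   : ∃[ r ] ∃[ c ] ∃[ s ] P r c ≡ just s

record IsLS {n : ℕ} (L : Fin n → Fin n → Fin n) : Set where
  field
    row-once : ∀ r s → ∃[ c ] (L r c ≡ s × (∀ c' → L r c' ≡ s → c' ≡ c))
    col-once : ∀ c s → ∃[ r ] (L r c ≡ s × (∀ r' → L r' c ≡ s → r' ≡ r))

Isotopism : ℕ → Set
Isotopism n = Permutation′ n × Permutation′ n × Permutation′ n

IsAutotopismP : ∀ {n} → Isotopism n → Array n → Set
IsAutotopismP {n} (α , β , γ) P =
  ∀ (t : Fin n × Fin n × Fin n) →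
    (t ∈O P) ⇔ (∃[ r ] ∃[ c ] ∃[ s ] ((r , c , s) ∈O P × t ≡ (α ⟨$⟩ʳ r , β ⟨$⟩ʳ c , γ ⟨$⟩ʳ s)))

toArray : ∀ {n} → (Fin n → Fin n → Fin n) → Array n
toArray L r c = just (L r c)

InLS : ∀ {n} → Isotopism n → (Fin n → Fin n → Fin n) → Set
InLS Θ L = IsLS L × IsAutotopismP Θ (toArray L)

InLSP : ∀ {n} → Isotopism n → Array n → (Fin n → Fin n → Fin n) → Set
InLSP {n} Θ P L = InLS Θ L × (∀ (t : Fin n × Fin n × Fin n) → t ∈O P → t ∈O toArray L)

InC : ∀ {n} → Isotopism n → Array n → Set
InC Θ P = IsPLS P × IsAutotopismP Θ P × ∃[ L ] InLSP Θ P L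

SamePLS : ∀ {n} → Array n → Array n → Set
SamePLS P Q = ∀ r c → P r c ≡ Q r c

record IsBasis {n : ℕ} (Θ : Isotopism n) (𝒫 : Array n → Set) : Set where
  field
    completable : ∀ P → 𝒫 P → InC Θ P
    covers      : ∀ L → InLS Θ L → ∃[ P ] (𝒫 P × InLSP Θ P L)
    disjoint    : ∀ P Q → 𝒫 P → 𝒫 Q → ¬ SamePLS P Q →
                  ∀ L → InLSP Θ P L → InLSP Θ Q L → Data.Empty.⊥

S-RC : ∀ {n} → Isotopism n → (Fin n × Fin n → Set) → Array n → Set
S-RC {n} Θ S P = InC Θ P × (∀ r c → (∃[ s ] P r c ≡ just s) ⇔ S (r , c))

S-RS : ∀ {n} → Isotopism n → (Fin n × Fin n → Set) → Array n → Set
S-RS {n} Θ S P = InC Θ P × (∀ r s → (∃[ c ] P r c ≡ just s) ⇔ S (r , s))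

S-CS : ∀ {n} → Isotopism n → (Fin n × Fin n → Set) → Array n → Set
S-CS {n} Θ S P = InC Θ P × (∀ c s → (∃[ r ] P r c ≡ just s) ⇔ S (c , s))

module Submission where

open import Defs
open import Data.Nat using (ℕ)
open import Data.Fin using (Fin; _≟_)
open import Data.Fin.Properties using (any?)
open import Data.Fin.Permutation using (Permutation′; _⟨$⟩ʳ_; _⟨$⟩ˡ_; inverseʳ)
open import Data.Maybe using (just; nothing)
open import Data.Maybe.Properties using (just-injective) renaming (≡-dec to ≡-decᴹ)
open import Data.Product using (∃; ∃-syntax; _×_; _,_; proj₁; proj₂)
open import Data.Product.Properties using () renaming (≡-dec to ≡-dec×)
open import Function.Bundles using (_⇔_; mk⇔; Equivalence; Injection)
open import Function.Properties.Equivalence using () renaming (sym to ⇔-sym; trans to ⇔-trans)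
open import Function.Properties.Inverse using (↔⇒↣)
open import Relation.Nullary using (Dec; yes; no)
open import Relation.Nullary.Decidable using (map′; _×-dec_)
open import Relation.Nullary.Negation using (contradiction)
open import Relation.Binary.PropositionalEquality

-- Each of the three projections (r,c,s) ↦ (r,c), (r,s), (c,s) restricts, on the cells of
-- a Latin square L, to a bijection onto [n]², and it intertwines Θ with an injective action
-- on pairs. If some Θ-completable P has shadow S, then S is invariant under that action; so
-- for each L ∈ LS_Θ the cells of L whose shadow lies in S form a Θ-invariant partial Latin
-- square with shadow S contained in L, and it is the only one, because a cell of L is
-- determined by its shadow. Hence the sets LS_{Θ,P} with P of shadow S partition LS_Θ.

Pair : ℕ → Set
Pair n = Fin n × Fin n

Square : ℕ → Set
Square n = Fin n → Fin n → Fin n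

⟨$⟩ʳ-injective : ∀ {n} (π : Permutation′ n) {i j} → π ⟨$⟩ʳ i ≡ π ⟨$⟩ʳ j → i ≡ j
⟨$⟩ʳ-injective π = Injection.injective (↔⇒↣ π)

module Autotopism {n : ℕ} (α β γ : Permutation′ n) where

  private
    Θ : Isotopism n
    Θ = α , β , γ

  autotopism-image : ∀ {P} → IsAutotopismP Θ P → ∀ {r c s} → P r c ≡ just s →
                     P (α ⟨$⟩ʳ r) (β ⟨$⟩ʳ c) ≡ just (γ ⟨$⟩ʳ s)
  autotopism-image A {r} {c} {s} e =
    Equivalence.from (A (α ⟨$⟩ʳ r , β ⟨$⟩ʳ c , γ ⟨$⟩ʳ s)) (r , c , s , e , refl)

  autotopism-preimage : ∀ {P} → IsAutotopismP Θ P → ∀ {r′ c′ s′} → P r′ c′ ≡ just s′ →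
                        ∃[ r ] ∃[ c ] ∃[ s ] (P r c ≡ just s ×
                          (r′ , c′ , s′) ≡ (α ⟨$⟩ʳ r , β ⟨$⟩ʳ c , γ ⟨$⟩ʳ s))
  autotopism-preimage A {r′} {c′} {s′} = Equivalence.to (A (r′ , c′ , s′))

  autotopism-square : ∀ {L} → IsAutotopismP Θ (toArray L) →
                      ∀ r c → L (α ⟨$⟩ʳ r) (β ⟨$⟩ʳ c) ≡ γ ⟨$⟩ʳ L r c
  autotopism-square A r c = just-injective (autotopism-image A refl)

module _ {n : ℕ} {Θ : Isotopism n} where

  IsBasis-resp-⇔ : ∀ {A B : Array n → Set} → (∀ P → A P ⇔ B P) →
                   IsBasis Θ A → IsBasis Θ B
  IsBasis-resp-⇔ {A} {B} A⇔B basis = record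
    { completable = λ P b → completable P (from P b)
    ; covers      = λ L L∈ → let (P , a , L∈P) = covers L L∈ in P , to P a , L∈P
    ; disjoint    = λ P Q b b′ → disjoint P Q (from P b) (from Q b′)
    }
    where
      open IsBasis basis
      to : ∀ P → A P → B P
      to P = Equivalence.to (A⇔B P)
      from : ∀ P → B P → A P
      from P = Equivalence.from (A⇔B P)

  IsBasis⇒nonempty : ∀ {A : Array n → Set} → (∃[ L ] InLS Θ L) → IsBasis Θ A → ∃[ P ] A P
  IsBasis⇒nonempty (L , L∈) basis =
    let (P , a , _) = IsBasis.covers basis L L∈ in P , a

_⊆ᴬ_ : ∀ {n} → Array n → Array n → Set
P ⊆ᴬ Q = ∀ {r c s} → P r c ≡ just s → Q r c ≡ just s

⊆ᴬ-antisym : ∀ {n} {P Q : Array n} → P ⊆ᴬ Q → Q ⊆ᴬ P → SamePLS P Q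
⊆ᴬ-antisym {P = P} {Q} P⊆Q Q⊆P r c with P r c in eP | Q r c in eQ
... | just _  | _       = trans (sym (P⊆Q eP)) eQ
... | nothing | just _  = trans (sym eP) (Q⊆P eQ)
... | nothing | nothing = refl

module Restriction {n : ℕ} (L : Square n) (D : Fin n → Fin n → Set)
                   (D? : ∀ r c → Dec (D r c)) where

  restrict : Array n
  restrict r c with D? r c
  ... | yes _ = just (L r c)
  ... | no _  = nothing

  restrict-just : ∀ {r c s} → restrict r c ≡ just s → D r c × L r c ≡ s
  restrict-just {r} {c} e with D? r c
  restrict-just e | yes d = d , just-injective e
  restrict-just () | no _

  restrict-yes : ∀ {r c} → D r c → restrict r c ≡ just (L r c)
  restrict-yes {r} {c} d with D? r c
  ... | yes _ = refl
  ... | no ¬d = contradiction d ¬d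

  restrict-⊆ : restrict ⊆ᴬ toArray L
  restrict-⊆ e = cong just (proj₂ (restrict-just e))

  restrict-isPLS : IsLS L → ∃[ r ] ∃[ c ] D r c → IsPLS restrict
  restrict-isPLS isLS (r , c , d) = record
    { row-unique = λ r c c′ s e e′ → once (IsLS.row-once isLS r s) (value e) (value e′)
    ; col-unique = λ r r′ c s e e′ → once (IsLS.col-once isLS c s) (value e) (value e′)
    ; nonempty   = r , c , L r c , restrict-yes d
    }
    where
      once : ∀ {A : Set} {f : A → Fin n} {s a a′} →
             ∃[ x ] (f x ≡ s × (∀ y → f y ≡ s → y ≡ x)) →
             f a ≡ s → f a′ ≡ s → a ≡ a′
      once (_ , _ , unique) e e′ = trans (unique _ e) (sym (unique _ e′))
      value : ∀ {r c s} → restrict r c ≡ just s → L r c ≡ s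
      value e = proj₂ (restrict-just e)

  module _ (α β γ : Permutation′ n) where

    open Autotopism α β γ

    restrict-autotopism : IsAutotopismP (α , β , γ) (toArray L) →
                          (∀ r c → D r c ⇔ D (α ⟨$⟩ʳ r) (β ⟨$⟩ʳ c)) →
                          IsAutotopismP (α , β , γ) restrict
    restrict-autotopism A D-inv (r′ , c′ , s′) = mk⇔ preimage image
      where
        image : ∀ {t} → ∃[ r ] ∃[ c ] ∃[ s ] (restrict r c ≡ just s ×
                  t ≡ (α ⟨$⟩ʳ r , β ⟨$⟩ʳ c , γ ⟨$⟩ʳ s)) → t ∈O restrict
        image (r , c , s , e , refl) with restrict-just e
        ... | d , refl = trans (restrict-yes (Equivalence.to (D-inv r c) d))
                               (cong just (autotopism-square A r c))

        r = α ⟨$⟩ˡ r′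
        c = β ⟨$⟩ˡ c′

        preimage : restrict r′ c′ ≡ just s′ → ∃[ r ] ∃[ c ] ∃[ s ] (restrict r c ≡ just s ×
                     (r′ , c′ , s′) ≡ (α ⟨$⟩ʳ r , β ⟨$⟩ʳ c , γ ⟨$⟩ʳ s))
        preimage e with restrict-just e | inverseʳ α {r′} | inverseʳ β {c′}
        ... | d , refl | αr≡r′ | βc≡c′ rewrite sym αr≡r′ | sym βc≡c′ =
          r , c , L r c , restrict-yes (Equivalence.from (D-inv r c) d) ,
          cong (λ s → (α ⟨$⟩ʳ r , β ⟨$⟩ʳ c , s)) (autotopism-square A r c)

Shadow : ∀ {n} → (Fin n → Fin n → Fin n → Pair n) → Array n → Pair n → Set
Shadow π P x = ∃[ r ] ∃[ c ] ∃[ s ] (P r c ≡ just s × π r c s ≡ x)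

shadow? : ∀ {n} (π : Fin n → Fin n → Fin n → Pair n) P x → Dec (Shadow π P x)
shadow? π P x = any? λ r → any? λ c → any? λ s →
  ≡-decᴹ _≟_ (P r c) (just s) ×-dec ≡-dec× _≟_ _≟_ (π r c s) x

record CellProjection {n : ℕ} (α β γ : Permutation′ n) : Set where
  field
    π                 : Fin n → Fin n → Fin n → Pair n
    act               : Pair n → Pair n
    π-equivariant     : ∀ r c s → π (α ⟨$⟩ʳ r) (β ⟨$⟩ʳ c) (γ ⟨$⟩ʳ s) ≡ act (π r c s)
    act-injective     : ∀ {x y} → act x ≡ act y → x ≡ y
    π-onto-cells      : ∀ {L} → IsLS L → ∀ x → ∃[ r ] ∃[ c ] π r c (L r c) ≡ x
    π-injective-cells : ∀ {L} → IsLS L → ∀ {r c r′ c′} →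
                        π r c (L r c) ≡ π r′ c′ (L r′ c′) → r ≡ r′ × c ≡ c′

module ShadowBasis {n : ℕ} {α β γ : Permutation′ n} (proj : CellProjection α β γ)
                   (S : Pair n → Set) where

  open CellProjection proj
  open Autotopism α β γ

  private
    Θ : Isotopism n
    Θ = α , β , γ

  HasShadow : Array n → Set
  HasShadow P = InC Θ P × (∀ x → Shadow π P x ⇔ S x)

  module _ {P₀ : Array n} (P₀-shadow : HasShadow P₀) where

    private
      A₀ : IsAutotopismP Θ P₀
      A₀ = proj₁ (proj₂ (proj₁ P₀-shadow))
      shadow⇔S : ∀ x → Shadow π P₀ x ⇔ S x
      shadow⇔S = proj₂ P₀-shadow

    S? : ∀ x → Dec (S x)
    S? x = map′ (Equivalence.to (shadow⇔S x)) (Equivalence.from (shadow⇔S x)) (shadow? π P₀ x)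

    S-act-invariant : ∀ x → S x ⇔ S (act x)
    S-act-invariant x = mk⇔ forward backward
      where
        forward : S x → S (act x)
        forward Sx with Equivalence.from (shadow⇔S x) Sx
        ... | r , c , s , e , refl = Equivalence.to (shadow⇔S _)
          (α ⟨$⟩ʳ r , β ⟨$⟩ʳ c , γ ⟨$⟩ʳ s , autotopism-image A₀ e , π-equivariant r c s)

        backward : S (act x) → S x
        backward Sax with Equivalence.from (shadow⇔S (act x)) Sax
        ... | _ , _ , _ , e′ , πe′≡ax with autotopism-preimage A₀ e′
        ... | r , c , s , e , refl = Equivalence.to (shadow⇔S x)
          (r , c , s , e , act-injective (trans (sym (π-equivariant r c s)) πe′≡ax))

    module _ (L : Square n) (L∈ : InLS Θ L) where

      private
        isLS : IsLS L
        isLS = proj₁ L∈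
        InS : Fin n → Fin n → Set
        InS r c = S (π r c (L r c))

      open Restriction L InS (λ r c → S? _)

      InS-invariant : ∀ r c → InS r c ⇔ InS (α ⟨$⟩ʳ r) (β ⟨$⟩ʳ c)
      InS-invariant r c = subst (λ y → InS r c ⇔ S y) (sym π-cell)
                                (S-act-invariant (π r c (L r c)))
        where
          π-cell : π (α ⟨$⟩ʳ r) (β ⟨$⟩ʳ c) (L (α ⟨$⟩ʳ r) (β ⟨$⟩ʳ c)) ≡ act (π r c (L r c))
          π-cell = trans (cong (π _ _) (autotopism-square (proj₂ L∈) r c)) (π-equivariant r c _)

      restrict-shadow : ∀ x → Shadow π restrict x ⇔ S x
      restrict-shadow x = mk⇔ to from
        where
          to : Shadow π restrict x → S x
          to (r , c , s , e , refl) with restrict-just e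
          ... | d , refl = d
          from : S x → Shadow π restrict x
          from Sx with π-onto-cells isLS x
          ... | r , c , refl = r , c , L r c , restrict-yes Sx , refl

      nonempty-InS : ∃[ r ] ∃[ c ] InS r c
      nonempty-InS with IsPLS.nonempty (proj₁ (proj₁ P₀-shadow))
      ... | r₀ , c₀ , s₀ , e₀ with π-onto-cells isLS (π r₀ c₀ s₀)
      ... | r , c , π≡ = r , c ,
            subst S (sym π≡) (Equivalence.to (shadow⇔S _) (r₀ , c₀ , s₀ , e₀ , refl))

      restrict-InLSP : InLSP Θ restrict L
      restrict-InLSP = L∈ , λ _ → restrict-⊆

      restrict-HasShadow : HasShadow restrict
      restrict-HasShadow =
        ( restrict-isPLS isLS nonempty-InS
        , restrict-autotopism α β γ (proj₂ L∈) InS-invariant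
        , L , restrict-InLSP )
        , restrict-shadow

  -- A cell (r,c,s) of P lies in L; its shadow is realised in Q by a cell of L, which
  -- must be the same cell since π is injective on the cells of L.
  shadow-⊆ : ∀ {P Q L} → HasShadow P → HasShadow Q → InLSP Θ P L → InLSP Θ Q L → P ⊆ᴬ Q
  shadow-⊆ (_ , shP) (_ , shQ) ((isLS , _) , P⊆L) (_ , Q⊆L) {r} {c} {s} e
    with Equivalence.from (shQ _) (Equivalence.to (shP (π r c s)) (r , c , s , e , refl))
  ... | r′ , c′ , s′ , e′ , π≡ with just-injective (P⊆L _ e) | just-injective (Q⊆L _ e′)
  ... | refl | refl with π-injective-cells isLS π≡
  ... | refl , refl = e′

  nonempty⇒basis : ∃[ P ] HasShadow P → IsBasis Θ HasShadow
  nonempty⇒basis (_ , P₀-shadow) = record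
    { completable = λ _ → proj₁
    ; covers      = λ L L∈ → _ , restrict-HasShadow P₀-shadow L L∈ , restrict-InLSP P₀-shadow L L∈
    ; disjoint    = λ P Q shP shQ P≢Q L P∈ Q∈ →
        P≢Q (⊆ᴬ-antisym (shadow-⊆ shP shQ P∈ Q∈) (shadow-⊆ shQ shP Q∈ P∈))
    }

  HasShadowᶜ : (Array n → Fin n → Fin n → Set) → Array n → Set
  HasShadowᶜ Cell P = InC Θ P × (∀ a b → Cell P a b ⇔ S (a , b))

  nonempty⇔basis : (Cell : Array n → Fin n → Fin n → Set) →
                   (∀ P a b → Cell P a b ⇔ Shadow π P (a , b)) → (∃[ L ] InLS Θ L) →
                   (∃[ P ] HasShadowᶜ Cell P) ⇔ IsBasis Θ (HasShadowᶜ Cell)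
  nonempty⇔basis Cell Cell⇔Shadow LS-nonempty = mk⇔
    (λ (P , shP) → IsBasis-resp-⇔ (λ Q → ⇔-sym (uncurried Q))
                                  (nonempty⇒basis (P , Equivalence.to (uncurried P) shP)))
    (IsBasis⇒nonempty LS-nonempty)
    where
      uncurried : ∀ P → HasShadowᶜ Cell P ⇔ HasShadow P
      uncurried P = mk⇔
        (λ (P∈ , h) → P∈ , λ (a , b) → ⇔-trans (⇔-sym (Cell⇔Shadow P a b)) (h a b))
        (λ (P∈ , h) → P∈ , λ a b → ⇔-trans (Cell⇔Shadow P a b) (h (a , b)))

pair-injective : ∀ {n} (f g : Permutation′ n) {x y : Pair n} →
                 (f ⟨$⟩ʳ proj₁ x , g ⟨$⟩ʳ proj₂ x) ≡ (f ⟨$⟩ʳ proj₁ y , g ⟨$⟩ʳ proj₂ y) → x ≡ y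
pair-injective f g e =
  cong₂ _,_ (⟨$⟩ʳ-injective f (cong proj₁ e)) (⟨$⟩ʳ-injective g (cong proj₂ e))

module _ {n : ℕ} (α β γ : Permutation′ n) where

  rowCol : CellProjection α β γ
  rowCol = record
    { π                 = λ r c _ → r , c
    ; act               = λ (r , c) → α ⟨$⟩ʳ r , β ⟨$⟩ʳ c
    ; π-equivariant     = λ _ _ _ → refl
    ; act-injective     = pair-injective α β
    ; π-onto-cells      = λ _ (r , c) → r , c , refl
    ; π-injective-cells = λ _ e → cong proj₁ e , cong proj₂ e
    }

  rowSym : CellProjection α β γ
  rowSym = record
    { π                 = λ r _ s → r , s
    ; act               = λ (r , s) → α ⟨$⟩ʳ r , γ ⟨$⟩ʳ s
    ; π-equivariant     = λ _ _ _ → refl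
    ; act-injective     = pair-injective α γ
    ; π-onto-cells      = λ isLS (r , s) →
        let (c , Lrc≡s , _) = IsLS.row-once isLS r s in r , c , cong (r ,_) Lrc≡s
    ; π-injective-cells = injective
    }
    where
      injective : ∀ {L} → IsLS L → ∀ {r c r′ c′} → (r , L r c) ≡ (r′ , L r′ c′) → r ≡ r′ × c ≡ c′
      injective {L} isLS {r} {c} {c′ = c′} e with cong proj₁ e
      ... | refl with IsLS.row-once isLS r (L r c)
      ... | _ , _ , unique = refl , trans (unique c refl) (sym (unique c′ (sym (cong proj₂ e))))

  colSym : CellProjection α β γ
  colSym = record
    { π                 = λ _ c s → c , s
    ; act               = λ (c , s) → β ⟨$⟩ʳ c , γ ⟨$⟩ʳ s
    ; π-equivariant     = λ _ _ _ → refl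
    ; act-injective     = pair-injective β γ
    ; π-onto-cells      = λ isLS (c , s) →
        let (r , Lrc≡s , _) = IsLS.col-once isLS c s in r , c , cong (c ,_) Lrc≡s
    ; π-injective-cells = injective
    }
    where
      injective : ∀ {L} → IsLS L → ∀ {r c r′ c′} → (c , L r c) ≡ (c′ , L r′ c′) → r ≡ r′ × c ≡ c′
      injective {L} isLS {r} {c} {r′} e with cong proj₁ e
      ... | refl with IsLS.col-once isLS c (L r c)
      ... | _ , _ , unique = trans (unique r refl) (sym (unique r′ (sym (cong proj₂ e)))) , refl

module _ {n : ℕ} {P : Array n} where

  rowCol-shadow : ∀ r c → (∃[ s ] P r c ≡ just s) ⇔ Shadow (λ r c _ → r , c) P (r , c)
  rowCol-shadow r c = mk⇔ (λ (s , e) → r , c , s , e , refl)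
                          (λ { (_ , _ , s , e , refl) → s , e })

  rowSym-shadow : ∀ r s → (∃[ c ] P r c ≡ just s) ⇔ Shadow (λ r _ s → r , s) P (r , s)
  rowSym-shadow r s = mk⇔ (λ (c , e) → r , c , s , e , refl)
                          (λ { (_ , c , _ , e , refl) → c , e })

  colSym-shadow : ∀ c s → (∃[ r ] P r c ≡ just s) ⇔ Shadow (λ _ c s → c , s) P (c , s)
  colSym-shadow c s = mk⇔ (λ (r , e) → r , c , s , e , refl)
                          (λ { (r , _ , _ , e , refl) → r , e })

lemma19 : (n : ℕ) (S : Fin n × Fin n → Set) (Θ : Isotopism n) →
          (∃[ L ] InLS Θ L) →
          ((∃[ P ] S-RC Θ S P) ⇔ IsBasis Θ (S-RC Θ S))
          × ((∃[ P ] S-RS Θ S P) ⇔ IsBasis Θ (S-RS Θ S))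
          × ((∃[ P ] S-CS Θ S P) ⇔ IsBasis Θ (S-CS Θ S))
lemma19 n S (α , β , γ) LS-nonempty =
    ShadowBasis.nonempty⇔basis (rowCol α β γ) S _ (λ _ → rowCol-shadow) LS-nonempty
  , ShadowBasis.nonempty⇔basis (rowSym α β γ) S _ (λ _ → rowSym-shadow) LS-nonempty
  , ShadowBasis.nonempty⇔basis (colSym α β γ) S _ (λ _ → colSym-shadow) LS-nonempty
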